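{- Let $n\in\mathbb{N}$ and let $F$ be a finite rooted poset with root $\bot$ and height greater than $1$, such that $F$ validates $\mathbf{PL}_n$. Let $s,t\in\mathrm{Top}(F)$. Then there is a path $p=a_0\cdots a_m$ from $s$ to $t$ lying in ${\Uparrow}\bot$ such that for each $i$: (I) ${\Uparrow}a_i=\varnothing$ when $i$ is even, and (II) ${\Uparrow}a_i=\{a_{i-1},a_{i+1}\}$ when $i$ is odd.
   Context: Formulas are those of intuitionistic propositional logic; an intermediate logic is a set of formulas containing $\mathbf{IPC}$ and closed under modus ponens and substitution. Kripke frames are posets with the usual intuitionistic validity. The height of a poset is the supremum of $|X|-1$ over chains $X$. For $x\in F$: ${\uparrow}x=\{y\mid y\ge x\}$, ${\Uparrow}x=\{y\mid y>x\}$, $\mathrm{depth}(x)$ is the height of ${\uparrow}x$, and $\mathrm{Top}(F)$ is the set of elements of depth $0$ (maximal elements). A path is a sequence $x_0\cdots x_k$ of elements with $x_i<x_{i+1}$ or $x_i>x_{i+1}$ for each $i$; it is from $x_0$ to $x_k$. $\mathbf{BD}_n$ is the logic of all finite posets of height at most $n$. A p-morphism $f\colon F\to G$ satisfies $f({\uparrow}x)={\uparrow}f(x)$. For a finite rooted poset $Q$, $\chi(Q)$ is its Jankov–Fine formula: a frame $F$ validates $\chi(Q)$ iff there is no surjective p-morphism from an upward-closed subset of $F$ onto $Q$. $\mathrm{Fork}_3$ is a root with three pairwise incomparable elements above it; $\mathrm{Scott}$ is $\{r,a,b,c\}$ with $r<a<b$, $r<c$, $c$ incomparable with $a,b$. $\mathbf{PL}$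 is the smallest intermediate logic containing $\chi(\mathrm{Fork}_3)$ and $\chi(\mathrm{Scott})$; $\mathbf{PL}_n$ is the smallest intermediate logic containing $\mathbf{BD}_n\cup\mathbf{PL}$. -}

module Defs where

open import Level using (0ℓ)
open import Data.Nat using (ℕ; zero; suc; _≤_; _<_; _∸_; _%_)
open import Data.Fin using (Fin; inject₁) renaming (zero to fz; suc to fs)
open import Data.Bool using (Bool; true; false; T)
open import Data.Product using (Σ; ∃; _×_; _,_)
open import Data.Sum using (_⊎_)
open import Data.Empty using (⊥)
open import Relation.Nullary using (¬_)
open import Relation.Binary.PropositionalEquality using (_≡_; _≢_)
open import Relation.Binary.Definitions using (Decidable)
open import Relation.Binary.Structures using (IsPartialOrder)

record FinPoset : Set₁ where
  field
    size  : ℕ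
    _≼_   : Fin size → Fin size → Set
    isPO  : IsPartialOrder _≡_ _≼_
    dec   : Decidable _≼_

  Car : Set
  Car = Fin size

  _≺_ : Car → Car → Set
  x ≺ y = (x ≼ y) × (x ≢ y)

open FinPoset public

Chain : (P : FinPoset) → ℕ → Set
Chain P m = Σ (Fin (suc m) → Car P) λ c →
  (i : Fin m) → _≺_ P (c (inject₁ i)) (c (fs i))

-- height P ≤ n  (height = sup of |X|-1 over chains X)
HeightLE : FinPoset → ℕ → Set
HeightLE P n = (m : ℕ) → Chain P m → m ≤ n

IsRoot : (P : FinPoset) → Car P → Set
IsRoot P r = (x : Car P) → _≼_ P r x

Top : (P : FinPoset) → Car P → Set
Top P x = ¬ (∃ λ y → _≺_ P x y)

data Formula : Set where
  var  : ℕ → Formula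
  ⊥f   : Formula
  _∧f_ : Formula → Formula → Formula
  _∨f_ : Formula → Formula → Formula
  _⇒f_ : Formula → Formula → Formula

record Valuation (P : FinPoset) : Set₁ where
  field
    val     : ℕ → Car P → Set
    persist : (p : ℕ) {x y : Car P} → _≼_ P x y → val p x → val p y

open Valuation public

Forces : (P : FinPoset) → Valuation P → Car P → Formula → Set
Forces P V x (var p)   = val V p x
Forces P V x ⊥f        = ⊥
Forces P V x (φ ∧f ψ)  = Forces P V x φ × Forces P V x ψ
Forces P V x (φ ∨f ψ)  = Forces P V x φ ⊎ Forces P V x ψ
Forces P V x (φ ⇒f ψ)  = (y : Car P) → _≼_ P x y → Forces P V y φ → Forces P V y ψ

Valid : FinPoset → Formula → Set₁
Valid P φ = (V : Valuation P) (x : Car P) → Forces P V x φ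

BD : ℕ → Formula → Set₁
BD n φ = (Q : FinPoset) → HeightLE Q n → Valid Q φ

ValidatesBD : FinPoset → ℕ → Set₁
ValidatesBD P n = (φ : Formula) → BD n φ → Valid P φ

record UpPMorphOnto (F : FinPoset) (Q : Set) (_⊑_ : Q → Q → Set) : Set₁ where
  field
    U       : Car F → Set
    upU     : {x y : Car F} → _≼_ F x y → U x → U y
    f       : (x : Car F) → U x → Q
    forth   : {x y : Car F} (ux : U x) (uy : U y) → _≼_ F x y → f x ux ⊑ f y uy
    back    : {x : Car F} (ux : U x) (q : Q) → f x ux ⊑ q →
              Σ (Car F) λ y → Σ (U y) λ uy → (_≼_ F x y) × (f y uy ≡ q)
    surj    : (q : Q) → Σ (Car F) λ x → Σ (U x) λ ux → f x ux ≡ q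

-- F ⊨ χ(Q)  iff  no surjective p-morphism from an up-set of F onto Q
ValidatesJankov : (F : FinPoset) (Q : Set) → (Q → Q → Set) → Set₁
ValidatesJankov F Q _⊑_ = ¬ UpPMorphOnto F Q _⊑_

fork3≤b : Fin 4 → Fin 4 → Bool
fork3≤b fz _ = true
fork3≤b (fs fz) (fs fz) = true
fork3≤b (fs (fs fz)) (fs (fs fz)) = true
fork3≤b (fs (fs (fs fz))) (fs (fs (fs fz))) = true
fork3≤b _ _ = false

Fork3≤ : Fin 4 → Fin 4 → Set
Fork3≤ x y = T (fork3≤b x y)

-- Scott: r = 0, a = 1, b = 2, c = 3 with r < a < b, r < c
scott≤b : Fin 4 → Fin 4 → Bool
scott≤b fz _ = true
scott≤b (fs fz) (fs fz) = true
scott≤b (fs fz) (fs (fs fz)) = true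
scott≤b (fs (fs fz)) (fs (fs fz)) = true
scott≤b (fs (fs (fs fz))) (fs (fs (fs fz))) = true
scott≤b _ _ = false

Scott≤ : Fin 4 → Fin 4 → Set
Scott≤ x y = T (scott≤b x y)

-- F ⊨ PL_n  (PL_n generated by BD_n ∪ {χ(Fork₃), χ(Scott)})
ValidatesPL : FinPoset → ℕ → Set₁
ValidatesPL F n = ValidatesBD F n
                × ValidatesJankov F (Fin 4) Fork3≤
                × ValidatesJankov F (Fin 4) Scott≤

IsPath : (P : FinPoset) (m : ℕ) → (ℕ → Car P) → Set
IsPath P m a = (i : ℕ) → i < m → _≺_ P (a i) (a (suc i)) ⊎ _≺_ P (a (suc i)) (a i)

-- Colour the maximal points by whether a zigzag to t is already known. While s is
-- not reached, ⊥ sees maximal points of both colours; take x maximal with this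
-- property. Every point strictly above x sees only one colour, so χ(Scott) forces
-- all of them to be maximal and χ(Fork₃) leaves exactly two, one of each colour.
-- Height greater than 1 keeps x off ⊥, so x joins a new maximal point to a reached one.

{-# OPTIONS --safe #-}
module Submission where

open import Defs
open import Data.Bool using (Bool; true; false; T?) renaming (_≟_ to _≟ᵇ_)
open import Data.Empty using (⊥-elim)
open import Data.Fin using (Fin; _≟_) renaming (zero to fz; suc to fs)
open import Data.Fin.Induction using (po-noetherian)
open import Data.Fin.Properties using (any?; all?)
open import Data.Fin.Subset using (Subset; _∈_; _∉_; _⊂_; _-_; ∁; ⁅_⁆)
open import Data.Fin.Subset.Induction using (⊂-wellFounded)
open import Data.Fin.Subset.Properties
  using (_∈?_; x∈⁅x⁆; x∈⁅y⁆⇒x≡y; x∈p⇒x∉∁p; x∉∁p⇒x∈p; p─q⊆p; x∈p⇒p-x⊂p; x∈p∧x≢y⇒x∈p-y)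
open import Data.Nat using (ℕ; zero; suc; _≤_; _∸_; _%_; z≤n; s≤s)
open import Data.Product using (Σ; ∃; ∃₂; _×_; _,_; proj₁; proj₂)
open import Data.Sum using (_⊎_; inj₁; inj₂)
open import Data.Unit using (⊤; tt)
open import Data.Vec using (lookup)
open import Data.Vec.Properties using ([]=⇒lookup; lookup⇒[]=)
open import Function using (_∘_; flip)
open import Induction.WellFounded using (Acc; acc)
open import Relation.Nullary using (¬_; yes; no; ¬?)
open import Relation.Nullary.Decidable using (_×-dec_; _→-dec_; toWitness)
open import Relation.Unary using (Pred) renaming (Decidable to Decidable₁)
open import Relation.Binary.Definitions using (Decidable)
open import Relation.Binary.PropositionalEquality using (_≡_; _≢_; refl; sym; trans; cong; subst)
open import Relation.Binary.Structures using (IsPartialOrder)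
import Relation.Binary.Construct.NonStrictToStrict as ToStrict

∉⇒lookup≡false : ∀ {n x} {U : Subset n} → x ∉ U → lookup U x ≡ false
∉⇒lookup≡false {x = x} {U} x∉U with lookup U x in Ux
... | true = ⊥-elim (x∉U (lookup⇒[]= x U Ux))
... | false = refl

lookup≡false⇒∉ : ∀ {n x} {U : Subset n} → lookup U x ≡ false → x ∉ U
lookup≡false⇒∉ Ux x∈U with () ← trans (sym ([]=⇒lookup x∈U)) Ux

module FiniteFrame (F : FinPoset) where

  X : Set
  X = Car F

  infix 4 _⊑_ _⊏_ _⊑?_ _⊏?_

  _⊑_ _⊏_ : X → X → Set
  _⊑_ = _≼_ F
  _⊏_ = _≺_ F

  open IsPartialOrder (isPO F)
    using () renaming (refl to ⊑-refl; trans to ⊑-trans; antisym to ⊑-antisym)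

  _⊑?_ : Decidable _⊑_
  _⊑?_ = dec F

  _⊏?_ : Decidable _⊏_
  _⊏?_ = ToStrict.<-decidable _≡_ _⊑_ _≟_ _⊑?_

  ⊏-⊑-trans : ∀ {x y z} → x ⊏ y → y ⊑ z → x ⊏ z
  ⊏-⊑-trans = ToStrict.<-≤-trans _≡_ _⊑_ sym ⊑-trans ⊑-antisym (λ { refl x⊑y → x⊑y })

  ⊑-⊏-trans : ∀ {x y z} → x ⊑ y → y ⊏ z → x ⊏ z
  ⊑-⊏-trans = ToStrict.≤-<-trans _≡_ _⊑_ ⊑-trans ⊑-antisym (λ { refl x⊑y → x⊑y })

  ⊏⇒≢ : ∀ {x y} → x ⊏ y → y ≢ x
  ⊏⇒≢ (_ , x≢y) = x≢y ∘ sym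

  top? : Decidable₁ (Top F)
  top? x = ¬? (any? (x ⊏?_))

  top-⊑⇒≡ : ∀ {e y} → Top F e → e ⊑ y → e ≡ y
  top-⊑⇒≡ {e} {y} top-e e⊑y with e ≟ y
  ... | yes e≡y = e≡y
  ... | no e≢y = ⊥-elim (top-e (y , e⊑y , e≢y))

  ⊑-top⇒⊏ : ∀ {x e} → ¬ Top F x → Top F e → x ⊑ e → x ⊏ e
  ⊑-top⇒⊏ ¬top-x top-e x⊑e = x⊑e , λ { refl → ¬top-x top-e }

  Maximal : ∀ {p} → Pred X p → Pred X _
  Maximal P m = P m × (∀ z → m ⊏ z → ¬ P z)

  maximal-above : ∀ {p} {P : Pred X p} → Decidable₁ P →
                  ∀ {y} → P y → ∃ λ m → y ⊑ m × Maximal P m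
  maximal-above {P = P} P? {y} = go (po-noetherian (isPO F) y)
    where
    go : ∀ {y} → Acc (flip _⊏_) y → P y → ∃ λ m → y ⊑ m × Maximal P m
    go {y} (acc larger) Py with any? (λ z → y ⊏? z ×-dec P? z)
    ... | no none = y , ⊑-refl , Py , λ z y⊏z Pz → none (z , y⊏z , Pz)
    ... | yes (z , y⊏z , Pz) with go (larger y⊏z) Pz
    ...   | m , z⊑m , max = m , ⊑-trans (proj₁ y⊏z) z⊑m , max

  top-above : ∀ y → ∃ λ e → y ⊑ e × Top F e
  top-above y with maximal-above {P = λ _ → ⊤} (λ _ → yes tt) tt
  ... | e , y⊑e , _ , max = e , y⊑e , λ (z , e⊏z) → max z e⊏z tt

  topAbove : X → X
  topAbove y = proj₁ (top-above y)

  ⊑-topAbove : ∀ y → y ⊑ topAbove y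
  ⊑-topAbove y = proj₁ (proj₂ (top-above y))

  topAbove-top : ∀ y → Top F (topAbove y)
  topAbove-top y = proj₂ (proj₂ (top-above y))

  three-chain : ¬ HeightLE F 1 → ∃₂ λ x₀ x₁ → ∃ λ x₂ → x₀ ⊏ x₁ × x₁ ⊏ x₂
  three-chain ¬height with any? (λ x₀ → any? λ x₁ → any? λ x₂ → x₀ ⊏? x₁ ×-dec x₁ ⊏? x₂)
  ... | yes chain = chain
  ... | no no-chain = ⊥-elim (¬height height≤1)
    where
    height≤1 : HeightLE F 1
    height≤1 zero _ = z≤n
    height≤1 (suc zero) _ = s≤s z≤n
    height≤1 (suc (suc m)) (c , c↑) =
      ⊥-elim (no-chain (c fz , c (fs fz) , c (fs (fs fz)) , c↑ fz , c↑ (fs fz)))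

  nontop-successor : ∀ {bot} → IsRoot F bot → ¬ HeightLE F 1 → ∃ λ z → bot ⊏ z × ¬ Top F z
  nontop-successor root ¬height with three-chain ¬height
  ... | x₀ , x₁ , x₂ , x₀⊏x₁ , x₁⊏x₂ =
    x₁ , ⊑-⊏-trans (root x₀) x₀⊏x₁ , λ top-x₁ → top-x₁ (x₂ , x₁⊏x₂)

  upPMorphOnto-fromView : ∀ {Q : Set} {_≤_ : Q → Q → Set} {V : X → Q → Set} (w : X) →
    (∀ x → ∃ (V x)) →
    (∀ {x p q} → V x p → V x q → p ≡ q) →
    (∀ {x y p q} → w ⊑ x → x ⊑ y → V x p → V y q → p ≤ q) →
    (∀ {x p q} → w ⊑ x → V x p → p ≤ q → ∃ λ y → x ⊑ y × V y q) →
    (∀ q → ∃ λ y → w ⊑ y × V y q) →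
    UpPMorphOnto F Q _≤_
  upPMorphOnto-fromView {V = V} w view functional monotone lift onto = record
    { U = w ⊑_
    ; upU = λ x⊑y w⊑x → ⊑-trans w⊑x x⊑y
    ; f = λ x _ → proj₁ (view x)
    ; forth = λ {x} {y} w⊑x _ x⊑y → monotone w⊑x x⊑y (proj₂ (view x)) (proj₂ (view y))
    ; back = λ {x} w⊑x q p≤q → reached (⊑-trans w⊑x) (lift w⊑x (proj₂ (view x)) p≤q)
    ; surj = λ q → let (y , w⊑y , Vyq) = onto q in y , w⊑y , functional (proj₂ (view y)) Vyq
    }
    where
    reached : ∀ {x q} → (∀ {y} → x ⊑ y → w ⊑ y) → ∃ (λ y → x ⊑ y × V y q) →
              Σ X λ y → Σ (w ⊑ y) λ _ → x ⊑ y × proj₁ (view y) ≡ q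
    reached up (y , x⊑y , Vyq) = y , up x⊑y , x⊑y , functional (proj₂ (view y)) Vyq

  module Fork3Morphism (w : X) (successors-top : ∀ z → w ⊏ z → Top F z)
    (p₁ p₂ p₃ : X) (w⊏p₁ : w ⊏ p₁) (w⊏p₂ : w ⊏ p₂) (w⊏p₃ : w ⊏ p₃)
    (p₁≢p₂ : p₁ ≢ p₂) (p₁≢p₃ : p₁ ≢ p₃) (p₂≢p₃ : p₂ ≢ p₃) where

    data View (x : X) : Fin 4 → Set where
      at-w  : x ≡ w → View x fz
      at-p₁ : x ≢ w → x ≡ p₁ → View x (fs fz)
      at-p₂ : x ≢ w → x ≢ p₁ → x ≡ p₂ → View x (fs (fs fz))
      at-rest : x ≢ w → x ≢ p₁ → x ≢ p₂ → View x (fs (fs (fs fz)))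

    view : ∀ x → ∃ (View x)
    view x with x ≟ w | x ≟ p₁ | x ≟ p₂
    ... | yes x≡w | _ | _ = _ , at-w x≡w
    ... | no x≢w | yes x≡p₁ | _ = _ , at-p₁ x≢w x≡p₁
    ... | no x≢w | no x≢p₁ | yes x≡p₂ = _ , at-p₂ x≢w x≢p₁ x≡p₂
    ... | no x≢w | no x≢p₁ | no x≢p₂ = _ , at-rest x≢w x≢p₁ x≢p₂

    functional : ∀ {x p q} → View x p → View x q → p ≡ q
    functional (at-w _) (at-w _) = refl
    functional (at-p₁ _ _) (at-p₁ _ _) = refl
    functional (at-p₂ _ _ _) (at-p₂ _ _ _) = refl
    functional (at-rest _ _ _) (at-rest _ _ _) = refl
    functional (at-w e) (at-p₁ n _) = ⊥-elim (n e)
    functional (at-w e) (at-p₂ n _ _) = ⊥-elim (n e)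
    functional (at-w e) (at-rest n _ _) = ⊥-elim (n e)
    functional (at-p₁ n _) (at-w e) = ⊥-elim (n e)
    functional (at-p₂ n _ _) (at-w e) = ⊥-elim (n e)
    functional (at-rest n _ _) (at-w e) = ⊥-elim (n e)
    functional (at-p₁ _ e) (at-p₂ _ n _) = ⊥-elim (n e)
    functional (at-p₁ _ e) (at-rest _ n _) = ⊥-elim (n e)
    functional (at-p₂ _ n _) (at-p₁ _ e) = ⊥-elim (n e)
    functional (at-rest _ n _) (at-p₁ _ e) = ⊥-elim (n e)
    functional (at-p₂ _ _ e) (at-rest _ _ n) = ⊥-elim (n e)
    functional (at-rest _ _ n) (at-p₂ _ _ e) = ⊥-elim (n e)

    leaf-≢w : ∀ {x i} → View x (fs i) → x ≢ w
    leaf-≢w (at-p₁ x≢w _) = x≢w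
    leaf-≢w (at-p₂ x≢w _ _) = x≢w
    leaf-≢w (at-rest x≢w _ _) = x≢w

    leaf-maximal : ∀ i q → Fork3≤ (fs i) q → fs i ≡ q
    leaf-maximal = toWitness {a? = all? λ i → all? λ q → T? (fork3≤b (fs i) q) →-dec (fs i ≟ q)} tt

    fork-refl : ∀ q → Fork3≤ q q
    fork-refl fz = tt
    fork-refl (fs fz) = tt
    fork-refl (fs (fs fz)) = tt
    fork-refl (fs (fs (fs fz))) = tt

    onto : ∀ q → ∃ λ y → w ⊑ y × View y q
    onto fz = w , ⊑-refl , at-w refl
    onto (fs fz) = p₁ , proj₁ w⊏p₁ , at-p₁ (⊏⇒≢ w⊏p₁) refl
    onto (fs (fs fz)) = p₂ , proj₁ w⊏p₂ , at-p₂ (⊏⇒≢ w⊏p₂) (p₁≢p₂ ∘ sym) refl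
    onto (fs (fs (fs fz))) = p₃ , proj₁ w⊏p₃ , at-rest (⊏⇒≢ w⊏p₃) (p₁≢p₃ ∘ sym) (p₂≢p₃ ∘ sym)

    monotone : ∀ {x y p q} → w ⊑ x → x ⊑ y → View x p → View y q → Fork3≤ p q
    monotone _ _ (at-w _) _ = tt
    monotone {p = fs i} w⊑x x⊑y vx vy
      with top-⊑⇒≡ (successors-top _ (w⊑x , leaf-≢w vx ∘ sym)) x⊑y
    ... | refl = subst (Fork3≤ _) (functional vx vy) (fork-refl _)

    lift : ∀ {x p q} → w ⊑ x → View x p → Fork3≤ p q → ∃ λ y → x ⊑ y × View y q
    lift _ (at-w refl) _ = onto _
    lift {x} {fs i} {q} _ vx p≤q = x , ⊑-refl , subst (View x) (leaf-maximal i q p≤q) vx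

    fork3-onto : UpPMorphOnto F (Fin 4) Fork3≤
    fork3-onto = upPMorphOnto-fromView w view functional monotone lift onto

  two-successors : ValidatesJankov F (Fin 4) Fork3≤ → ∀ {w u v} →
    (∀ z → w ⊏ z → Top F z) → w ⊏ u → w ⊏ v → u ≢ v → ∀ z → w ⊏ z → z ≡ u ⊎ z ≡ v
  two-successors fork-free {w} {u} {v} successors-top w⊏u w⊏v u≢v z w⊏z with z ≟ u | z ≟ v
  ... | yes z≡u | _ = inj₁ z≡u
  ... | no _ | yes z≡v = inj₂ z≡v
  ... | no z≢u | no z≢v = ⊥-elim (fork-free (Fork3Morphism.fork3-onto w successors-top
                                    u v z w⊏u w⊏v w⊏z u≢v (z≢u ∘ sym) (z≢v ∘ sym)))

  module Colouring (C : X → Bool) where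

    Monochrome : X → Set
    Monochrome z = ∀ {u v} → Top F u → Top F v → z ⊑ u → z ⊑ v → C u ≡ C v

    Bichromatic : X → Set
    Bichromatic z = ∃₂ λ u v → Top F u × Top F v × z ⊑ u × z ⊑ v × C u ≡ true × C v ≡ false

    bichromatic? : Decidable₁ Bichromatic
    bichromatic? z = any? λ u → any? λ v →
      top? u ×-dec top? v ×-dec z ⊑? u ×-dec z ⊑? v ×-dec C u ≟ᵇ true ×-dec C v ≟ᵇ false

    ¬bichromatic⇒monochrome : ∀ {z} → ¬ Bichromatic z → Monochrome z
    ¬bichromatic⇒monochrome ¬bi {u} {v} top-u top-v z⊑u z⊑v with C u in Cu | C v in Cv
    ... | true | true = refl
    ... | false | false = refl
    ... | true | false = ⊥-elim (¬bi (u , v , top-u , top-v , z⊑u , z⊑v , Cu , Cv))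
    ... | false | true = ⊥-elim (¬bi (v , u , top-v , top-u , z⊑v , z⊑u , Cv , Cu))

    true-false⇒≢ : ∀ {u v} → C u ≡ true → C v ≡ false → u ≢ v
    true-false⇒≢ Cu Cv refl with () ← trans (sym Cu) Cv

    bichromatic⇒¬top : ∀ {z} → Bichromatic z → ¬ Top F z
    bichromatic⇒¬top (u , v , _ , _ , z⊑u , z⊑v , Cu , Cv) top-z =
      true-false⇒≢ {u} Cu Cv (trans (sym (top-⊑⇒≡ top-z z⊑u)) (top-⊑⇒≡ top-z z⊑v))

    opposite-colour : ∀ {w} → Bichromatic w → ∀ b → ∃ λ d → Top F d × w ⊑ d × C d ≢ b
    opposite-colour (_ , v , _ , top-v , _ , w⊑v , _ , Cv) true = v , top-v , w⊑v , λ Cv≡true →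
      true-false⇒≢ {v} Cv≡true Cv refl
    opposite-colour (u , _ , top-u , _ , w⊑u , _ , Cu , _) false = u , top-u , w⊑u , λ Cu≡false →
      true-false⇒≢ {u} Cu Cu≡false refl

    colour : X → Bool
    colour x = C (topAbove x)

    module ScottMorphism (w : X) (monochrome : ∀ z → w ⊏ z → Monochrome z)
      (z₀ : X) (w⊏z₀ : w ⊏ z₀) (¬top-z₀ : ¬ Top F z₀)
      (d : X) (top-d : Top F d) (w⊑d : w ⊑ d) (Cd≢colour-z₀ : C d ≢ colour z₀) where

      colour-⊑ : ∀ {x y} → w ⊏ x → x ⊑ y → colour y ≡ colour x
      colour-⊑ {x} {y} w⊏x x⊑y = monochrome x w⊏x (topAbove-top y) (topAbove-top x)
        (⊑-trans x⊑y (⊑-topAbove y)) (⊑-topAbove x)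

      ≢w-upward : ∀ {x y} → w ⊑ x → x ⊑ y → x ≢ w → y ≢ w
      ≢w-upward w⊑x x⊑y x≢w refl = x≢w (⊑-antisym x⊑y w⊑x)

      data View (x : X) : Fin 4 → Set where
        at-r : x ≡ w → View x fz
        at-a : x ≢ w → colour x ≡ colour z₀ → ¬ Top F x → View x (fs fz)
        at-b : x ≢ w → colour x ≡ colour z₀ → Top F x → View x (fs (fs fz))
        at-c : x ≢ w → colour x ≢ colour z₀ → View x (fs (fs (fs fz)))

      view : ∀ x → ∃ (View x)
      view x with x ≟ w | colour x ≟ᵇ colour z₀ | top? x
      ... | yes x≡w | _ | _ = _ , at-r x≡w
      ... | no x≢w | yes same | no ¬top = _ , at-a x≢w same ¬top
      ... | no x≢w | yes same | yes top = _ , at-b x≢w same top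
      ... | no x≢w | no other | _ = _ , at-c x≢w other

      functional : ∀ {x p q} → View x p → View x q → p ≡ q
      functional (at-r _) (at-r _) = refl
      functional (at-a _ _ _) (at-a _ _ _) = refl
      functional (at-b _ _ _) (at-b _ _ _) = refl
      functional (at-c _ _) (at-c _ _) = refl
      functional (at-r e) (at-a n _ _) = ⊥-elim (n e)
      functional (at-r e) (at-b n _ _) = ⊥-elim (n e)
      functional (at-r e) (at-c n _) = ⊥-elim (n e)
      functional (at-a n _ _) (at-r e) = ⊥-elim (n e)
      functional (at-b n _ _) (at-r e) = ⊥-elim (n e)
      functional (at-c n _) (at-r e) = ⊥-elim (n e)
      functional (at-a _ _ n) (at-b _ _ e) = ⊥-elim (n e)
      functional (at-b _ _ e) (at-a _ _ n) = ⊥-elim (n e)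
      functional (at-a _ e _) (at-c _ n) = ⊥-elim (n e)
      functional (at-b _ e _) (at-c _ n) = ⊥-elim (n e)
      functional (at-c _ n) (at-a _ e _) = ⊥-elim (n e)
      functional (at-c _ n) (at-b _ e _) = ⊥-elim (n e)

      onto : ∀ q → ∃ λ y → w ⊑ y × View y q
      onto fz = w , ⊑-refl , at-r refl
      onto (fs fz) = z₀ , proj₁ w⊏z₀ , at-a (⊏⇒≢ w⊏z₀) refl ¬top-z₀
      onto (fs (fs fz)) = topAbove z₀ , ⊑-trans (proj₁ w⊏z₀) (⊑-topAbove z₀) ,
        at-b (⊏⇒≢ (⊏-⊑-trans w⊏z₀ (⊑-topAbove z₀))) (colour-⊑ w⊏z₀ (⊑-topAbove z₀))
             (topAbove-top z₀)
      onto (fs (fs (fs fz))) = d , w⊑d ,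
        at-c (λ { refl → top-d (z₀ , w⊏z₀) })
             (Cd≢colour-z₀ ∘ trans (cong C (top-⊑⇒≡ top-d (⊑-topAbove d))))

      monotone : ∀ {x y p q} → w ⊑ x → x ⊑ y → View x p → View y q → Scott≤ p q
      monotone _ _ (at-r _) _ = tt
      monotone w⊑x x⊑y (at-a x≢w same _) vy =
        below vy (≢w-upward w⊑x x⊑y x≢w) (trans (colour-⊑ (w⊑x , x≢w ∘ sym) x⊑y) same)
        where
        below : ∀ {y q} → View y q → y ≢ w → colour y ≡ colour z₀ → Scott≤ (fs fz) q
        below (at-r y≡w) y≢w _ = ⊥-elim (y≢w y≡w)
        below (at-a _ _ _) _ _ = tt
        below (at-b _ _ _) _ _ = tt
        below (at-c _ other) _ same = ⊥-elim (other same)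
      monotone _ x⊑y vx@(at-b _ _ top-x) vy with top-⊑⇒≡ top-x x⊑y
      ... | refl = subst (Scott≤ _) (functional vx vy) tt
      monotone w⊑x x⊑y (at-c x≢w other) vy =
        beside vy (≢w-upward w⊑x x⊑y x≢w) (other ∘ trans (sym (colour-⊑ (w⊑x , x≢w ∘ sym) x⊑y)))
        where
        beside : ∀ {y q} → View y q → y ≢ w → colour y ≢ colour z₀ → Scott≤ (fs (fs (fs fz))) q
        beside (at-r y≡w) y≢w _ = ⊥-elim (y≢w y≡w)
        beside (at-a _ same _) _ other = ⊥-elim (other same)
        beside (at-b _ same _) _ other = ⊥-elim (other same)
        beside (at-c _ _) _ _ = tt

      lift : ∀ {x p q} → w ⊑ x → View x p → Scott≤ p q → ∃ λ y → x ⊑ y × View y q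
      lift _ (at-r refl) _ = onto _
      lift {x} {q = fs fz} _ vx@(at-a _ _ _) _ = x , ⊑-refl , vx
      lift {x} {q = fs (fs fz)} w⊑x (at-a x≢w same _) _ = topAbove x , ⊑-topAbove x ,
        at-b (≢w-upward w⊑x (⊑-topAbove x) x≢w)
             (trans (colour-⊑ (w⊑x , x≢w ∘ sym) (⊑-topAbove x)) same) (topAbove-top x)
      lift {x} {q = fs (fs fz)} _ vx@(at-b _ _ _) _ = x , ⊑-refl , vx
      lift {x} {q = fs (fs (fs fz))} _ vx@(at-c _ _) _ = x , ⊑-refl , vx
      lift {q = fz} _ (at-a _ _ _) ()
      lift {q = fs (fs (fs fz))} _ (at-a _ _ _) ()
      lift {q = fz} _ (at-b _ _ _) ()
      lift {q = fs fz} _ (at-b _ _ _) ()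
      lift {q = fs (fs (fs fz))} _ (at-b _ _ _) ()
      lift {q = fz} _ (at-c _ _) ()
      lift {q = fs fz} _ (at-c _ _) ()
      lift {q = fs (fs fz)} _ (at-c _ _) ()

      scott-onto : UpPMorphOnto F (Fin 4) Scott≤
      scott-onto = upPMorphOnto-fromView w view functional monotone lift onto

    successors-top : ValidatesJankov F (Fin 4) Scott≤ → ∀ {w} → Bichromatic w →
      (∀ z → w ⊏ z → Monochrome z) → ∀ z → w ⊏ z → Top F z
    successors-top scott-free {w} bichromatic monochrome z w⊏z with top? z
    ... | yes top-z = top-z
    ... | no ¬top-z with opposite-colour bichromatic (colour z)
    ...   | d , top-d , w⊑d , Cd≢ =
      ⊥-elim (scott-free (ScottMorphism.scott-onto w monochrome z w⊏z ¬top-z d top-d w⊑d Cd≢))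

  module Rooted (bot : X) (root : IsRoot F bot) (nontop : ∃ λ z → bot ⊏ z × ¬ Top F z) where

    record Span (u x v : X) : Set where
      field
        bot⊏x : bot ⊏ x
        top-u : Top F u
        x⊏u : x ⊏ u
        x⊏v : x ⊏ v
        successors : ∀ y → x ⊏ y → y ≡ u ⊎ y ≡ v

    bot⊏top : ∀ {t} → Top F t → bot ⊏ t
    bot⊏top top-t = root _ , λ { refl → top-t (proj₁ nontop , proj₁ (proj₂ nontop)) }

    span-between : ValidatesJankov F (Fin 4) Fork3≤ → ValidatesJankov F (Fin 4) Scott≤ →
      (C : X → Bool) → ∀ {s t} → Top F s → Top F t → C s ≡ true → C t ≡ false →
      ∃₂ λ u x → ∃ λ v → C u ≡ true × C v ≡ false × Span u x v
    span-between fork-free scott-free C {s} {t} top-s top-t Cs Ct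
      with maximal-above (Colouring.bichromatic? C)
                         (s , t , top-s , top-t , root s , root t , Cs , Ct)
    ... | x , bot⊑x , bichromatic@(u , v , top-u , top-v , x⊑u , x⊑v , Cu , Cv) , maximal =
      u , x , v , Cu , Cv , record
        { bot⊏x = bot⊑x , bot≢x
        ; top-u = top-u
        ; x⊏u = x⊏u
        ; x⊏v = x⊏v
        ; successors = two-successors fork-free x-successors-top x⊏u x⊏v (true-false⇒≢ Cu Cv)
        }
      where
      open Colouring C
      x⊏u : x ⊏ u
      x⊏u = ⊑-top⇒⊏ (bichromatic⇒¬top bichromatic) top-u x⊑u
      x⊏v : x ⊏ v
      x⊏v = ⊑-top⇒⊏ (bichromatic⇒¬top bichromatic) top-v x⊑v
      x-successors-top : ∀ z → x ⊏ z → Top F z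
      x-successors-top = successors-top scott-free bichromatic
        (λ z x⊏z → ¬bichromatic⇒monochrome (maximal z x⊏z))
      bot≢x : bot ≢ x
      bot≢x refl = let (z , bot⊏z , ¬top-z) = nontop in ¬top-z (x-successors-top z bot⊏z)

    span-across : ValidatesJankov F (Fin 4) Fork3≤ → ValidatesJankov F (Fin 4) Scott≤ →
      ∀ {s t} → Top F s → Top F t → (U : Subset (size F)) → s ∈ U → t ∉ U →
      ∃₂ λ u x → ∃ λ v → u ∈ U × v ∉ U × Span u x v
    span-across fork-free scott-free top-s top-t U s∈U t∉U
      with span-between fork-free scott-free (lookup U) top-s top-t
                        ([]=⇒lookup s∈U) (∉⇒lookup≡false t∉U)
    ... | u , x , v , Uu , Uv , span =
      u , x , v , lookup⇒[]= u U Uu , lookup≡false⇒∉ Uv , span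

    module Zigzags (t : X) (top-t : Top F t) where

      infixr 5 _∷_

      data Zigzag : X → Set where
        []  : Zigzag t
        _∷_ : ∀ {u x v} → Span u x v → Zigzag v → Zigzag u

      length : ∀ {u} → Zigzag u → ℕ
      length [] = 0
      length (_ ∷ p) = suc (suc (length p))

      vertex : ∀ {u} → Zigzag u → ℕ → X
      vertex {u} _ zero = u
      vertex [] (suc _) = t
      vertex (_∷_ {x = x} _ _) (suc zero) = x
      vertex (_ ∷ p) (suc (suc i)) = vertex p i

      vertex-last : ∀ {u} (p : Zigzag u) → vertex p (length p) ≡ t
      vertex-last [] = refl
      vertex-last (_ ∷ p) = vertex-last p

      vertex-path : ∀ {u} (p : Zigzag u) → IsPath F (length p) (vertex p)
      vertex-path (span ∷ _) zero _ = inj₂ (Span.x⊏u span)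
      vertex-path (span ∷ _) (suc zero) _ = inj₁ (Span.x⊏v span)
      vertex-path (_ ∷ p) (suc (suc i)) (s≤s (s≤s i<n)) = vertex-path p i i<n

      vertex-above-bot : ∀ {u} (p : Zigzag u) i → i ≤ length p → bot ⊏ vertex p i
      vertex-above-bot [] zero _ = bot⊏top top-t
      vertex-above-bot (span ∷ _) zero _ = ⊏-⊑-trans (Span.bot⊏x span) (proj₁ (Span.x⊏u span))
      vertex-above-bot (span ∷ _) (suc zero) _ = Span.bot⊏x span
      vertex-above-bot (_ ∷ p) (suc (suc i)) (s≤s (s≤s i≤n)) = vertex-above-bot p i i≤n

      vertex-even : ∀ {u} (p : Zigzag u) i → i ≤ length p → i % 2 ≡ 0 → Top F (vertex p i)
      vertex-even [] zero _ _ = top-t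
      vertex-even (span ∷ _) zero _ _ = Span.top-u span
      vertex-even (_ ∷ p) (suc (suc i)) (s≤s (s≤s i≤n)) even = vertex-even p i i≤n even

      vertex-odd : ∀ {u} (p : Zigzag u) i → i ≤ length p → i % 2 ≡ 1 → (y : X) →
        (vertex p i ⊏ y → y ≡ vertex p (i ∸ 1) ⊎ y ≡ vertex p (suc i))
        × (y ≡ vertex p (i ∸ 1) ⊎ y ≡ vertex p (suc i) → vertex p i ⊏ y)
      vertex-odd (span ∷ _) (suc zero) _ _ y =
        Span.successors span y , λ { (inj₁ refl) → Span.x⊏u span ; (inj₂ refl) → Span.x⊏v span }
      vertex-odd (_ ∷ p) (suc (suc (suc i))) (s≤s (s≤s i≤n)) odd = vertex-odd p (suc i) i≤n odd

      zigzag-from : ∀ s → (∀ U → s ∈ U → t ∉ U → ∃₂ λ u x → ∃ λ v → u ∈ U × v ∉ U × Span u x v) →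
                    Zigzag s
      zigzag-from s cross = go (∁ ⁅ t ⁆) (⊂-wellFounded _) (x∈p⇒x∉∁p (x∈⁅x⁆ t)) from-t
        where
        from-t : ∀ z → z ∉ ∁ ⁅ t ⁆ → Zigzag z
        from-t z z∉ with x∈⁅y⁆⇒x≡y t (x∉∁p⇒x∈p z∉)
        ... | refl = []
        go : ∀ U → Acc _⊂_ U → t ∉ U → (∀ z → z ∉ U → Zigzag z) → Zigzag s
        go U (acc smaller) t∉U outside with s ∈? U
        ... | no s∉U = outside s s∉U
        ... | yes s∈U with cross U s∈U t∉U
        ...   | u , _ , v , u∈U , v∉U , span =
          go (U - u) (smaller (x∈p⇒p-x⊂p u∈U)) (t∉U ∘ p─q⊆p U ⁅ u ⁆) outside′
          where
          outside′ : ∀ z → z ∉ U - u → Zigzag z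
          outside′ z z∉U-u with z ≟ u
          ... | yes refl = span ∷ outside v v∉U
          ... | no z≢u = outside z (z∉U-u ∘ flip x∈p∧x≢y⇒x∈p-y z≢u)

lemma7p4 : (n : ℕ) (F : FinPoset) (bot : Car F) → IsRoot F bot →
    ¬ HeightLE F 1 → ValidatesPL F n →
    (s t : Car F) → Top F s → Top F t →
    Σ ℕ λ m → Σ (ℕ → Car F) λ a →
      (a 0 ≡ s) × (a m ≡ t) × IsPath F m a
      × ((i : ℕ) → i ≤ m → _≺_ F bot (a i))
      × ((i : ℕ) → i ≤ m → i % 2 ≡ 0 → ¬ (∃ λ y → _≺_ F (a i) y))
      × ((i : ℕ) → i ≤ m → i % 2 ≡ 1 → (y : Car F) →
           (_≺_ F (a i) y → (y ≡ a (i ∸ 1)) ⊎ (y ≡ a (suc i)))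
           × ((y ≡ a (i ∸ 1)) ⊎ (y ≡ a (suc i)) → _≺_ F (a i) y))
lemma7p4 _ F bot root ¬height (_ , fork-free , scott-free) s t top-s top-t =
  length p , vertex p , refl , vertex-last p , vertex-path p ,
  vertex-above-bot p , vertex-even p , vertex-odd p
  where
  open FiniteFrame F
  open Rooted bot root (nontop-successor root ¬height)
  open Zigzags t top-t
  p : Zigzag s
  p = zigzag-from s (span-across fork-free scott-free top-s top-t)
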